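{- Let $n\ge 1$ and let $\mu,\rho$ be convex permutations of $[n]$. Let $S$ be the bipartite graph with vertex set $A\cup B\cup C$, where $A=\{a_1,\dots,a_n\}$, $B=\{b_1,\dots,b_n\}$, $C=\{c_1,\dots,c_n\}$ are pairwise disjoint, and whose edges are exactly: $b_ia_j$ for all $i\in[n]$ and $1\le j\le\rho(i)$, and $b_ic_j$ for all $i\in[n]$ and $1\le j\le \mu(i)$ (so $S$ has parts $A\cup C$ and $B$). Then $S$ is a biconvex graph containing neither $P_8$ nor $\widetilde{P}_8$ as an induced subgraph.
   Context: All graphs are finite, simple and undirected. A permutation $\sigma$ of $[n]=\{1,\dots,n\}$ is convex if for every $1\le i\le n$ the set $\sigma^{ -1}(\{i,i+1,\dots,n\})$ is a set of consecutive integers. $P_k$ denotes the chordless path on $k$ vertices; for a bipartite graph $G=(V_1,V_2,E)$ its bipartite complement is $(V_1,V_2,(V_1\times V_2)\setminus E)$, and $\widetilde{P}_8$ is the bipartite complement of $P_8$. A bipartite graph with parts $X,Y$ is biconvex if $X$ and $Y$ can each be linearly ordered so that the neighborhood of every vertex consists of consecutive vertices in the order of the opposite part. -}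

module Defs where

open import Data.Nat using (ℕ; zero; suc; _≤_; _%_)
open import Data.Fin using (Fin; toℕ)
open import Data.Fin.Permutation using (Permutation′; _⟨$⟩ʳ_)
open import Data.Sum using (_⊎_; inj₁; inj₂)
open import Data.Product using (Σ; _×_; _,_; ∃)
open import Data.Empty using (⊥)
open import Relation.Nullary using (¬_)
open import Relation.Binary.PropositionalEquality using (_≡_; _≢_)
open import Function.Bundles using (_⤖_; Bijection)
open import Function.Definitions using (Injective)

-- [n] is represented by Fin n, with element i : Fin n standing for toℕ i + 1.

Consecutive : ∀ {m} → (Fin m → Set) → Set
Consecutive {m} P =
  ∀ (i j k : Fin m) → toℕ i ≤ toℕ j → toℕ j ≤ toℕ k → P i → P k → P j

ConvexPerm : ∀ {n} → Permutation′ n → Set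
ConvexPerm {n} σ =
  ∀ (t : Fin n) → Consecutive (λ i → toℕ t ≤ toℕ (σ ⟨$⟩ʳ i))

-- Biconvex: X and Y admit linear orders (bijections with Fin p, Fin q)
-- such that every neighbourhood is consecutive in the order of the other part.
Biconvex : {X Y : Set} → (X → Y → Set) → Set
Biconvex {X} {Y} E =
  Σ ℕ λ p → Σ ℕ λ q → Σ (Fin p ⤖ X) λ ox → Σ (Fin q ⤖ Y) λ oy →
    (∀ (x : X) → Consecutive (λ j → E x (Bijection.to oy j)))
  × (∀ (y : Y) → Consecutive (λ i → E (Bijection.to ox i) y))

BipAdj : {X Y : Set} → (X → Y → Set) → X ⊎ Y → X ⊎ Y → Set
BipAdj E (inj₁ x) (inj₁ x′) = ⊥
BipAdj E (inj₁ x) (inj₂ y) = E x y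
BipAdj E (inj₂ y) (inj₁ x) = E x y
BipAdj E (inj₂ y) (inj₂ y′) = ⊥

-- The graph S.  Parts: A ∪ C (as Fin n ⊎ Fin n, inj₁ = a, inj₂ = c) and B (Fin n).
-- b_i a_j edge iff j ≤ ρ(i);  b_i c_j edge iff j ≤ μ(i)  (1-based, equivalently 0-based).
SEdge : ∀ {n} → (μ ρ : Permutation′ n) → Fin n ⊎ Fin n → Fin n → Set
SEdge μ ρ (inj₁ j) i = toℕ j ≤ toℕ (ρ ⟨$⟩ʳ i)
SEdge μ ρ (inj₂ j) i = toℕ j ≤ toℕ (μ ⟨$⟩ʳ i)

-- Chordless path P₈ on vertices 0,…,7 and its bipartite complement
-- (w.r.t. its bipartition into even / odd vertices).
P8Adj : Fin 8 → Fin 8 → Set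
P8Adj i j = (toℕ j ≡ suc (toℕ i)) ⊎ (toℕ i ≡ suc (toℕ j))

P8BipCompAdj : Fin 8 → Fin 8 → Set
P8BipCompAdj i j = (toℕ i % 2 ≢ toℕ j % 2) × ¬ P8Adj i j

InducedSubgraph : ∀ {k} {V : Set} → (Fin k → Fin k → Set) → (V → V → Set) → Set
InducedSubgraph {k} {V} H G =
  Σ (Fin k → V) λ f → Injective _≡_ _≡_ f ×
    (∀ i j → (H i j → G (f i) (f j)) × (G (f i) (f j) → H i j))

module Submission where

-- Everything rests on one observation:
-- the neighbourhood of a_j is {b_i : j ≤ ρ(i)}, a threshold set, so the
-- neighbourhoods of A form a chain under inclusion, and likewise for C.
--
-- Order X as a_n, …, a_1, c_1, …, c_n and B as b_1, …, b_n.
-- The neighbourhood of a_j (c_j) is consecutive because ρ (μ) is convex, and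
-- the neighbourhood of b_i is a final segment of the reversed A-block followed
-- by an initial segment of the C-block, hence consecutive.
--
-- Call two vertices incomparable if neither
-- neighbourhood contains the other.  A bipartite graph whose left part is
-- covered by two chains has no three pairwise incomparable left vertices
-- (two of them lie in the same chain).  Both P₈ and its bipartite complement
-- contain a "zigzag": a walk w₀ … w₅ whose even and odd vertices form two
-- pairwise incomparable triples.  An induced embedding preserves edges and
-- incomparability and puts w₀, w₂, w₄ (or w₁, w₃, w₅) into the left part,
-- which is impossible.

open import Defs
open import Data.Nat using (ℕ; suc; s≤s; _≤_; _+_; _%_)
open import Data.Nat.Properties
  using (_≟_; ≤-trans; ≤-total; ∸-monoʳ-≤; +-cancelˡ-≤; m≤m+n; <⇒≱; ≤-<-trans)
open import Data.Fin using (Fin; toℕ; splitAt; opposite; #_)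
open import Data.Fin.Properties
  using (+↔⊎; opposite-prop; opposite-involutive; splitAt⁻¹-↑ˡ; splitAt⁻¹-↑ʳ;
         toℕ-↑ˡ; toℕ-↑ʳ; toℕ<n; any?)
open import Data.Fin.Permutation using (Permutation′; _⟨$⟩ʳ_)
open import Data.Sum using (_⊎_; inj₁; inj₂; map₁; [_,_]′)
open import Data.Sum.Function.Propositional using (_⊎-↔_)
open import Data.Product using (Σ; _×_; _,_; proj₁; proj₂)
open import Data.Unit using (⊤; tt)
open import Data.Empty using (⊥; ⊥-elim)
open import Relation.Nullary using (¬_; Dec; ¬?; _×-dec_; _⊎-dec_)
open import Relation.Nullary.Decidable using (True; toWitness)
open import Relation.Binary.PropositionalEquality using (_≡_; refl; sym; trans; cong; subst₂)
open import Function.Base using (_∘_)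
open import Function.Bundles using (_↔_; mk↔ₛ′)
open import Function.Properties.Inverse using (↔⇒⤖)
open import Function.Construct.Identity using (↔-id; ⤖-id)
open import Function.Construct.Composition using (_↔-∘_)

DownClosed : ∀ {m} → (Fin m → Set) → Set
DownClosed P = ∀ {j j′} → toℕ j′ ≤ toℕ j → P j → P j′

threshold-downClosed : ∀ {m} (t : ℕ) → DownClosed {m} (λ j → toℕ j ≤ t)
threshold-downClosed t j′≤j j≤t = ≤-trans j′≤j j≤t

opposite-antitone : ∀ {m} (j j′ : Fin m) →
  toℕ j ≤ toℕ j′ → toℕ (opposite j′) ≤ toℕ (opposite j)
opposite-antitone {m} j j′ j≤j′
  rewrite opposite-prop j | opposite-prop j′ = ∸-monoʳ-≤ m (s≤s j≤j′)

opposite-↔ : ∀ {m} → Fin m ↔ Fin m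
opposite-↔ = mk↔ₛ′ opposite opposite opposite-involutive opposite-involutive

reversedThenForward : ∀ m n → Fin (m + n) ↔ (Fin m ⊎ Fin n)
reversedThenForward m n = (opposite-↔ ⊎-↔ ↔-id _) ↔-∘ +↔⊎

position-first : ∀ {m n} {k : Fin (m + n)} {j} → splitAt m k ≡ inj₁ j → toℕ k ≡ toℕ j
position-first {m} {n} {k} {j} eq = trans (sym (cong toℕ (splitAt⁻¹-↑ˡ eq))) (toℕ-↑ˡ j n)

position-second : ∀ {m n} {k : Fin (m + n)} {j} → splitAt m k ≡ inj₂ j → toℕ k ≡ m + toℕ j
position-second {m} {n} {k} {j} eq = trans (sym (cong toℕ (splitAt⁻¹-↑ʳ eq))) (toℕ-↑ʳ m j)

first-before-second : ∀ {m n} {k k′ : Fin (m + n)} {j j′} →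
  splitAt m k ≡ inj₁ j → splitAt m k′ ≡ inj₂ j′ → ¬ toℕ k′ ≤ toℕ k
first-before-second {m} {k = k} {k′} {j} {j′} eq eq′ k′≤k =
  <⇒≱ (≤-<-trans (subst₂ _≤_ refl (position-first eq) k′≤k) (toℕ<n j))
       (subst₂ _≤_ refl (sym (position-second eq′)) (m≤m+n m (toℕ j′)))

-- A union of down-closed sets of both blocks is consecutive in the order
-- above: it is a final segment of the reversed first block followed by an
-- initial segment of the second block.
downClosed-consecutive : ∀ {m n} (R : Fin m ⊎ Fin n → Set) →
  DownClosed (R ∘ inj₁) → DownClosed (R ∘ inj₂) →
  Consecutive (λ k → R (map₁ opposite (splitAt m k)))
downClosed-consecutive {m} R down₁ down₂ k₁ k₂ k₃ k₁≤k₂ k₂≤k₃ Rk₁ Rk₃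
  with splitAt m k₁ in e₁ | splitAt m k₂ in e₂ | splitAt m k₃ in e₃
... | inj₁ j₁ | inj₁ j₂ | _ =
  down₁ (opposite-antitone j₁ j₂ (subst₂ _≤_ (position-first e₁) (position-first e₂) k₁≤k₂)) Rk₁
... | inj₂ _ | inj₁ _ | _ = ⊥-elim (first-before-second e₂ e₁ k₁≤k₂)
... | _ | inj₂ j₂ | inj₂ j₃ =
  down₂ (+-cancelˡ-≤ m _ _ (subst₂ _≤_ (position-second e₂) (position-second e₃) k₂≤k₃)) Rk₃
... | _ | inj₂ _ | inj₁ _ = ⊥-elim (first-before-second e₃ e₂ k₂≤k₃)

-- The neighbourhood of b_i is the union of two threshold sets.
S-biconvex : ∀ {n} (μ ρ : Permutation′ n) →
  ConvexPerm μ → ConvexPerm ρ → Biconvex (SEdge μ ρ)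
S-biconvex {n} μ ρ convexμ convexρ =
  n + n , n , ↔⇒⤖ (reversedThenForward n n) , ⤖-id (Fin n) , neighbourhoodX , neighbourhoodB
  where
  neighbourhoodX : ∀ x → Consecutive (λ i → SEdge μ ρ x i)
  neighbourhoodX (inj₁ j) = convexρ j
  neighbourhoodX (inj₂ j) = convexμ j

  neighbourhoodB : ∀ i → Consecutive (λ k → SEdge μ ρ (map₁ opposite (splitAt n k)) i)
  neighbourhoodB i = downClosed-consecutive (λ x → SEdge μ ρ x i)
    (threshold-downClosed (toℕ (ρ ⟨$⟩ʳ i))) (threshold-downClosed (toℕ (μ ⟨$⟩ʳ i)))

Incomparable : {V : Set} → (V → V → Set) → V → V → Set
Incomparable {V} G u v = Σ V λ w → Σ V λ w′ → G u w × ¬ G v w × G v w′ × ¬ G u w′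

IncomparableTriple : {V : Set} → (V → V → Set) → V → V → V → Set
IncomparableTriple G u v w = Incomparable G u v × Incomparable G u w × Incomparable G v w

module Embedding {k} {V : Set} {H : Fin k → Fin k → Set} {G : V → V → Set}
  (f : Fin k → V) (induced : ∀ i j → (H i j → G (f i) (f j)) × (G (f i) (f j) → H i j)) where

  edge : ∀ {i j} → H i j → G (f i) (f j)
  edge {i} {j} = proj₁ (induced i j)

  nonEdge : ∀ {i j} → ¬ H i j → ¬ G (f i) (f j)
  nonEdge {i} {j} ¬h = ¬h ∘ proj₂ (induced i j)

  incomparable : ∀ {i j} → Incomparable H i j → Incomparable G (f i) (f j)
  incomparable (w , w′ , a , b , c , d) = f w , f w′ , edge a , nonEdge b , edge c , nonEdge d

  incomparableTriple : ∀ {u v w} → IncomparableTriple H u v w → IncomparableTriple G (f u) (f v) (f w)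
  incomparableTriple (uv , uw , vw) = incomparable uv , incomparable uw , incomparable vw

module _ {X Y : Set} where

  Comparable : (X → Y → Set) → X → X → Set
  Comparable E x x′ = (∀ y → E x y → E x′ y) ⊎ (∀ y → E x′ y → E x y)

  IsChain : (X → Y → Set) → Set
  IsChain E = ∀ x x′ → Comparable E x x′

  comparable⇒¬incomparable : ∀ {E : X → Y → Set} {x x′} →
    Comparable E x x′ → ¬ Incomparable (BipAdj E) (inj₁ x) (inj₁ x′)
  comparable⇒¬incomparable (inj₁ x⊆x′) (inj₂ y , _ , e , ¬e′ , _) = ¬e′ (x⊆x′ y e)
  comparable⇒¬incomparable (inj₂ x′⊆x) (_ , inj₂ y′ , _ , _ , e′ , ¬e) = ¬e (x′⊆x y′ e′)

  threshold-chain : (h : X → ℕ) (g : Y → ℕ) → IsChain (λ x y → h x ≤ g y)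
  threshold-chain h g x x′ with ≤-total (h x) (h x′)
  ... | inj₁ x≤x′ = inj₂ (λ y → ≤-trans x≤x′)
  ... | inj₂ x′≤x = inj₁ (λ y → ≤-trans x′≤x)

  OnLeft : X ⊎ Y → Set
  OnLeft (inj₁ _) = ⊤
  OnLeft (inj₂ _) = ⊥

  edge-meets-left : ∀ {E : X → Y → Set} {u v} → BipAdj E u v → OnLeft u ⊎ OnLeft v
  edge-meets-left {u = inj₁ _} _ = inj₁ tt
  edge-meets-left {u = inj₂ _} {inj₁ _} _ = inj₂ tt

  two-steps-stay-left : ∀ {E : X → Y → Set} {u w v} →
    BipAdj E u w → BipAdj E w v → OnLeft u → OnLeft v
  two-steps-stay-left {u = inj₁ _} {inj₂ _} {inj₁ _} _ _ _ = tt
  two-steps-stay-left {u = inj₁ _} {inj₂ _} {inj₂ _} _ () _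

TwoChains : {P Q Y : Set} → (P ⊎ Q → Y → Set) → Set
TwoChains E = IsChain (E ∘ inj₁) × IsChain (E ∘ inj₂)

-- Pigeonhole: two of three left vertices lie in the same chain.
twoChains⇒noIncomparableTriple : ∀ {P Q Y : Set} {E : P ⊎ Q → Y → Set} → TwoChains E →
  ∀ {u v w} → OnLeft u → OnLeft v → OnLeft w → ¬ IncomparableTriple (BipAdj E) u v w
twoChains⇒noIncomparableTriple {E = E} (chainP , chainQ) {inj₁ x} {inj₁ x′} {inj₁ x″} _ _ _ (uv , uw , vw) =
  sameChain x x′ x″ uv uw vw
  where
  sameChain : ∀ a b c → Incomparable (BipAdj E) (inj₁ a) (inj₁ b) →
    Incomparable (BipAdj E) (inj₁ a) (inj₁ c) → Incomparable (BipAdj E) (inj₁ b) (inj₁ c) → ⊥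
  sameChain (inj₁ a) (inj₁ b) _ ab _ _ = comparable⇒¬incomparable (chainP a b) ab
  sameChain (inj₂ a) (inj₂ b) _ ab _ _ = comparable⇒¬incomparable (chainQ a b) ab
  sameChain (inj₁ a) (inj₂ _) (inj₁ c) _ ac _ = comparable⇒¬incomparable (chainP a c) ac
  sameChain (inj₂ a) (inj₁ _) (inj₂ c) _ ac _ = comparable⇒¬incomparable (chainQ a c) ac
  sameChain (inj₁ _) (inj₂ b) (inj₂ c) _ _ bc = comparable⇒¬incomparable (chainQ b c) bc
  sameChain (inj₂ _) (inj₁ b) (inj₁ c) _ _ bc = comparable⇒¬incomparable (chainP b c) bc

record Zigzag {V : Set} (H : V → V → Set) : Set where
  constructor zigzag
  field
    w₀ w₁ w₂ w₃ w₄ w₅ : V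
    walk : H w₀ w₁ × H w₁ w₂ × H w₂ w₃ × H w₃ w₄ × H w₄ w₅
    evenTriple : IncomparableTriple H w₀ w₂ w₄
    oddTriple : IncomparableTriple H w₁ w₃ w₅

-- A graph with a zigzag is not an induced subgraph of a bipartite graph whose
-- left part is covered by two chains: whichever end of the edge w₀w₁ is on
-- the left, the triple containing it lies entirely on the left.
zigzag-not-induced : ∀ {k} {H : Fin k → Fin k → Set} {P Q Y : Set} {E : P ⊎ Q → Y → Set} →
  Zigzag H → TwoChains E → ¬ InducedSubgraph H (BipAdj E)
zigzag-not-induced {H = H} {E = E} (zigzag w₀ w₁ w₂ w₃ w₄ w₅ (s₀₁ , s₁₂ , s₂₃ , s₃₄ , s₄₅) even odd)
  chains (f , _ , induced) = [ evenOnLeft , oddOnLeft ]′ (edge-meets-left {E = E} (edge s₀₁))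
  where
  open Embedding {G = BipAdj E} f induced

  stay : ∀ {a b c} → H a b → H b c → OnLeft (f a) → OnLeft (f c)
  stay ab bc = two-steps-stay-left {E = E} (edge ab) (edge bc)

  evenOnLeft : OnLeft (f w₀) → ⊥
  evenOnLeft left₀ = twoChains⇒noIncomparableTriple chains
    left₀ (stay s₀₁ s₁₂ left₀) (stay s₂₃ s₃₄ (stay s₀₁ s₁₂ left₀)) (incomparableTriple even)

  oddOnLeft : OnLeft (f w₁) → ⊥
  oddOnLeft left₁ = twoChains⇒noIncomparableTriple chains
    left₁ (stay s₁₂ s₂₃ left₁) (stay s₃₄ s₄₅ (stay s₁₂ s₂₃ left₁)) (incomparableTriple odd)

module Certify {k} {H : Fin k → Fin k → Set} (adj? : ∀ i j → Dec (H i j)) where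

  incomparable? : ∀ u v → Dec (Incomparable H u v)
  incomparable? u v = any? λ w → any? λ w′ →
    adj? u w ×-dec ¬? (adj? v w) ×-dec adj? v w′ ×-dec ¬? (adj? u w′)

  incomparableTriple? : ∀ u v w → Dec (IncomparableTriple H u v w)
  incomparableTriple? u v w = incomparable? u v ×-dec incomparable? u w ×-dec incomparable? v w

  walk? : ∀ w₀ w₁ w₂ w₃ w₄ w₅ → Dec (H w₀ w₁ × H w₁ w₂ × H w₂ w₃ × H w₃ w₄ × H w₄ w₅)
  walk? w₀ w₁ w₂ w₃ w₄ w₅ = adj? w₀ w₁ ×-dec adj? w₁ w₂ ×-dec adj? w₂ w₃ ×-dec adj? w₃ w₄ ×-dec adj? w₄ w₅

  zigzagByEvaluation : ∀ w₀ w₁ w₂ w₃ w₄ w₅ →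
    {True (walk? w₀ w₁ w₂ w₃ w₄ w₅)} →
    {True (incomparableTriple? w₀ w₂ w₄)} → {True (incomparableTriple? w₁ w₃ w₅)} → Zigzag H
  zigzagByEvaluation w₀ w₁ w₂ w₃ w₄ w₅ {walk} {even} {odd} =
    zigzag w₀ w₁ w₂ w₃ w₄ w₅ (toWitness walk) (toWitness even) (toWitness odd)

p8Adj? : ∀ i j → Dec (P8Adj i j)
p8Adj? i j = (toℕ j ≟ suc (toℕ i)) ⊎-dec (toℕ i ≟ suc (toℕ j))

p8BipCompAdj? : ∀ i j → Dec (P8BipCompAdj i j)
p8BipCompAdj? i j = ¬? (toℕ i % 2 ≟ toℕ j % 2) ×-dec ¬? (p8Adj? i j)

-- In P₈: the walk 1-2-3-4-5-6, with N(1)={0,2}, N(3)={2,4}, N(5)={4,6}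
-- and N(2)={1,3}, N(4)={3,5}, N(6)={5,7}.
p8-zigzag : Zigzag P8Adj
p8-zigzag = zigzagByEvaluation (# 1) (# 2) (# 3) (# 4) (# 5) (# 6)
  where open Certify p8Adj?

-- In the bipartite complement of P₈: the walk 1-4-7-0-3-6, with
-- N(1)={4,6}, N(7)={0,2,4}, N(3)={0,6} and N(4)={1,7}, N(0)={3,5,7}, N(6)={1,3}.
p8BipComp-zigzag : Zigzag P8BipCompAdj
p8BipComp-zigzag = zigzagByEvaluation (# 1) (# 4) (# 7) (# 0) (# 3) (# 6)
  where open Certify p8BipCompAdj?

S-twoChains : ∀ {n} (μ ρ : Permutation′ n) → TwoChains (SEdge μ ρ)
S-twoChains μ ρ = threshold-chain toℕ (λ i → toℕ (ρ ⟨$⟩ʳ i)) , threshold-chain toℕ (λ i → toℕ (μ ⟨$⟩ʳ i))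

mainTheorem9 : (n : ℕ) → 1 ≤ n → (μ ρ : Permutation′ n) →
    ConvexPerm μ → ConvexPerm ρ →
    Biconvex (SEdge μ ρ)
    × ¬ InducedSubgraph P8Adj (BipAdj (SEdge μ ρ))
    × ¬ InducedSubgraph P8BipCompAdj (BipAdj (SEdge μ ρ))
mainTheorem9 n _ μ ρ convexμ convexρ =
    S-biconvex μ ρ convexμ convexρ
  , zigzag-not-induced p8-zigzag (S-twoChains μ ρ)
  , zigzag-not-induced p8BipComp-zigzag (S-twoChains μ ρ)
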